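{- Let $M$ be an abelian group and let $B_1 \subseteq B_2 \subseteq M$ be structuring elements. Then $B_1 \subseteq_{S,M} B_2$ if and only if there are finitely many $v_1, \dots, v_n \in M$ such that $$B_2 = B_1 \cup \left( \bigcup_{i=1}^n (B_1 + v_i) \right).$$
   Context: A structuring element is a finite set $B$ with $0 \in B \subseteq M$. For $A \subseteq M$ and $v \in M$, $A + v = \{a + v : a \in A\}$. With pixel set $P = M$, the shift inclusion $B_1 \subseteq_{S,M} B_2$ means: $B_1 \subseteq B_2$ and for every $b_2 \in B_2$ there exists $b_1 \in B_1$ such that $B_1 + (b_2 - b_1) \subseteq B_2$. (In general, for a pixel set $P \subseteq M$, $B_1 \subseteq_{S,P} B_2$ means $B_1 \subseteq B_2$ and: for all $x \in P$ and $b_2 \in B_2$ with $x + b_2 \in P$ there is $b_1 \in B_1$ with $x + b_1 \in P$ and $B_1 + (b_2 - b_1) \subseteq B_2$; and for all $x \in P$ and $b_2 \in B_2$ with $x - b_2 \in P$ there is $b_1 \in B_1$ with $x - b_1 \in P$ and $B_1 + (b_2 - b_1) \subseteq B_2$. For $P = M$ this reduces to the condition above.) -}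

module Defs where

open import Level using (Level; _⊔_)
open import Algebra.Bundles using (AbelianGroup)
open import Data.List using (List; map; concatMap; _++_)
open import Data.Product using (Σ; _×_; ∃-syntax)
import Data.List.Membership.Setoid as SetoidMembership

module _ {c ℓ : Level} (M : AbelianGroup c ℓ) where
  open AbelianGroup M renaming (Carrier to A)
  open SetoidMembership setoid using (_∈_)

  -- finite subsets of M are represented by lists (membership up to ≈)
  _⊆ₘ_ : List A → List A → Set (c ⊔ ℓ)
  X ⊆ₘ Y = ∀ {x} → x ∈ X → x ∈ Y

  _≐ₘ_ : List A → List A → Set (c ⊔ ℓ)
  X ≐ₘ Y = (X ⊆ₘ Y) × (Y ⊆ₘ X)

  _+ₛ_ : List A → A → List A
  X +ₛ v = map (λ a → a ∙ v) X

  _−_ : A → A → A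
  x − y = x ∙ (y ⁻¹)

  StructuringElement : List A → Set (c ⊔ ℓ)
  StructuringElement B = ε ∈ B

  -- shift inclusion B₁ ⊆_{S,M} B₂ (pixel set P = M)
  ShiftIncl : List A → List A → Set (c ⊔ ℓ)
  ShiftIncl B₁ B₂ =
    (B₁ ⊆ₘ B₂) ×
    (∀ b₂ → b₂ ∈ B₂ → ∃[ b₁ ] ((b₁ ∈ B₁) × ((B₁ +ₛ (b₂ − b₁)) ⊆ₘ B₂)))

  unionTranslates : List A → List A → List A
  unionTranslates B₁ vs = B₁ ++ concatMap (λ v → B₁ +ₛ v) vs

-- B₁ ⊆_{S,M} B₂ says exactly that every b₂ ∈ B₂ lies in a translate B₁ + v contained in B₂
-- (take v = b₂ − b₁, since b₁ + v = b₂). As B₂ is finite, finitely many such translates cover it,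
-- and together with B₁ ⊆ B₂ this is the decomposition. Conversely, if b₂ = a + v lies in a
-- translate B₁ + v ⊆ B₂, then b₁ = a witnesses the shift condition; B₁ itself is the translate by 0.
module Submission where

open import Defs
open import Level using (Level; _⊔_)
open import Algebra.Bundles using (AbelianGroup)
open import Relation.Binary.Bundles using (Setoid)
open import Data.List using (List; []; _∷_; concatMap; _++_)
open import Data.List.Relation.Unary.Any using (here; there)
open import Data.Product using (_×_; ∃-syntax; _,_; proj₁; proj₂)
open import Data.Sum using (inj₁; inj₂; [_,_]′)
open import Function.Bundles using (_⇔_; mk⇔)
import Data.List.Membership.Setoid as Membership
import Data.List.Membership.Setoid.Properties as Membershipₚ
import Data.List.Relation.Binary.Subset.Setoid as Subset
open import Data.List.Relation.Binary.Subset.Setoid.Properties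
  using (⊆-trans; xs⊆xs++ys; xs⊆ys++xs; ∈-∷⁺ʳ; ++⁺ˡ)

module UnionOfFamily {a ℓ} (S : Setoid a ℓ) where
  open Setoid S renaming (Carrier to A)
  open Membership S using (_∈_)
  open Subset S using (_⊆_)

  ++-lub : ∀ {xs ys zs} → xs ⊆ zs → ys ⊆ zs → xs ++ ys ⊆ zs
  ++-lub {xs} xs⊆zs ys⊆zs p = [ xs⊆zs , ys⊆zs ]′ (Membershipₚ.∈-++⁻ S xs p)

  module _ {i} {I : Set i} (F : I → List A) where

    ∈-concatMap⁻ : ∀ {x} is → x ∈ concatMap F is →
                   ∃[ j ] (x ∈ F j × F j ⊆ concatMap F is)
    ∈-concatMap⁻ (j ∷ is) p with Membershipₚ.∈-++⁻ S (F j) p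
    ... | inj₁ x∈Fj = j , x∈Fj , xs⊆xs++ys S (F j) (concatMap F is)
    ... | inj₂ x∈rest with ∈-concatMap⁻ is x∈rest
    ...   | k , x∈Fk , Fk⊆rest = k , x∈Fk , ⊆-trans S Fk⊆rest (xs⊆ys++xs S _ (F j))

    finite-cover : ∀ {Y} L → (∀ x → x ∈ L → ∃[ j ] (x ∈ F j × F j ⊆ Y)) →
                   ∃[ is ] (L ⊆ concatMap F is × concatMap F is ⊆ Y)
    finite-cover []      _   = [] , (λ ()) , (λ ())
    finite-cover (x ∷ L) cov with cov x (here refl) | finite-cover L (λ y p → cov y (there p))
    ... | j , x∈Fj , Fj⊆Y | is , L⊆⋃ , ⋃⊆Y =
      j ∷ is ,
      ∈-∷⁺ʳ S (xs⊆xs++ys S (F j) _ x∈Fj) (⊆-trans S L⊆⋃ (xs⊆ys++xs S _ (F j))) ,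
      ++-lub Fj⊆Y ⋃⊆Y

module _ {c ℓ : Level} (M : AbelianGroup c ℓ) where
  open AbelianGroup M renaming (Carrier to A)
  open import Algebra.Properties.AbelianGroup M using (xyx⁻¹≈y)
  open Membership setoid using (_∈_)
  open Subset setoid using (_⊆_)
  open UnionOfFamily setoid

  translates : List A → List A → List A
  translates B vs = concatMap (_+ₛ_ M B) vs

  ShiftCondition : List A → List A → Set (c ⊔ ℓ)
  ShiftCondition B₁ B₂ = ∀ b₂ → b₂ ∈ B₂ → ∃[ b₁ ] (b₁ ∈ B₁ × _+ₛ_ M B₁ (_−_ M b₂ b₁) ⊆ B₂)

  ∈-+ₛ⁺ : ∀ {X a v} → a ∈ X → a ∙ v ∈ _+ₛ_ M X v
  ∈-+ₛ⁺ = Membershipₚ.∈-map⁺ setoid setoid ∙-congʳ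

  ∈-+ₛ⁻ : ∀ {X x v} → x ∈ _+ₛ_ M X v → ∃[ a ] (a ∈ X × x ≈ a ∙ v)
  ∈-+ₛ⁻ = Membershipₚ.∈-map⁻ setoid setoid

  +ₛ-congˡ : ∀ X {v w} → v ≈ w → _+ₛ_ M X v ⊆ _+ₛ_ M X w
  +ₛ-congˡ X v≈w p with ∈-+ₛ⁻ {X} p
  ... | a , a∈X , x≈a∙v = Membershipₚ.∈-resp-≈ setoid (sym (trans x≈a∙v (∙-congˡ v≈w))) (∈-+ₛ⁺ a∈X)

  +ₛ-identityʳ : ∀ X → _≐ₘ_ M (_+ₛ_ M X ε) X
  +ₛ-identityʳ X = from , to
    where
    from : _+ₛ_ M X ε ⊆ X
    from p with ∈-+ₛ⁻ {X} p
    ... | a , a∈X , x≈a∙ε = Membershipₚ.∈-resp-≈ setoid (sym (trans x≈a∙ε (identityʳ a))) a∈X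
    to : X ⊆ _+ₛ_ M X ε
    to a∈X = Membershipₚ.∈-resp-≈ setoid (identityʳ _) (∈-+ₛ⁺ a∈X)

  x∙[y−x]≈y : ∀ x y → x ∙ _−_ M y x ≈ y
  x∙[y−x]≈y x y = trans (sym (assoc x y (x ⁻¹))) (xyx⁻¹≈y x y)

  ∈-+ₛ-difference : ∀ {B b₁} b₂ → b₁ ∈ B → b₂ ∈ _+ₛ_ M B (_−_ M b₂ b₁)
  ∈-+ₛ-difference {b₁ = b₁} b₂ b₁∈B =
    Membershipₚ.∈-resp-≈ setoid (x∙[y−x]≈y b₁ b₂) (∈-+ₛ⁺ b₁∈B)

  shift⇒translates : ∀ {B₁ B₂} → ShiftCondition B₁ B₂ →
                     ∃[ vs ] _≐ₘ_ M B₂ (translates B₁ vs)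
  shift⇒translates {B₁} {B₂} shift = finite-cover (_+ₛ_ M B₁) B₂ cover
    where
    cover : ∀ b₂ → b₂ ∈ B₂ → ∃[ v ] (b₂ ∈ _+ₛ_ M B₁ v × _+ₛ_ M B₁ v ⊆ B₂)
    cover b₂ b₂∈B₂ with shift b₂ b₂∈B₂
    ... | b₁ , b₁∈B₁ , translate⊆B₂ = _ , ∈-+ₛ-difference b₂ b₁∈B₁ , translate⊆B₂

  translates⇒shift : ∀ {B₁ B₂} vs → _≐ₘ_ M B₂ (translates B₁ vs) → ShiftCondition B₁ B₂
  translates⇒shift {B₁} vs (B₂⊆⋃ , ⋃⊆B₂) b₂ b₂∈B₂ with ∈-concatMap⁻ (_+ₛ_ M B₁) vs (B₂⊆⋃ b₂∈B₂)
  ... | v , b₂∈B₁+v , B₁+v⊆⋃ with ∈-+ₛ⁻ {B₁} b₂∈B₁+v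
  ...   | a , a∈B₁ , b₂≈a∙v =
    a , a∈B₁ , ⊆-trans setoid (+ₛ-congˡ B₁ b₂−a≈v) (⊆-trans setoid B₁+v⊆⋃ ⋃⊆B₂)
    where
    b₂−a≈v : _−_ M b₂ a ≈ v
    b₂−a≈v = trans (∙-congʳ b₂≈a∙v) (xyx⁻¹≈y a v)

theorem3 : {c ℓ : Level} (M : AbelianGroup c ℓ) (B₁ B₂ : List (AbelianGroup.Carrier M)) →
    StructuringElement M B₁ → StructuringElement M B₂ → _⊆ₘ_ M B₁ B₂ →
    ShiftIncl M B₁ B₂ ⇔ (∃[ vs ] _≐ₘ_ M B₂ (unionTranslates M B₁ vs))
theorem3 M B₁ B₂ _ _ B₁⊆B₂ = mk⇔ to from
  where
  open AbelianGroup M using (ε; setoid)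
  open UnionOfFamily setoid using (++-lub)

  to : ShiftIncl M B₁ B₂ → ∃[ vs ] _≐ₘ_ M B₂ (unionTranslates M B₁ vs)
  to (_ , shift) with shift⇒translates M shift
  ... | vs , B₂⊆⋃ , ⋃⊆B₂ = vs , ⊆-trans setoid B₂⊆⋃ (xs⊆ys++xs setoid _ B₁) , ++-lub B₁⊆B₂ ⋃⊆B₂

  -- B₁ is the translate of itself by ε, so the decomposition is a union of translates only.
  from : ∃[ vs ] _≐ₘ_ M B₂ (unionTranslates M B₁ vs) → ShiftIncl M B₁ B₂
  from (vs , B₂⊆∪ , ∪⊆B₂) =
    B₁⊆B₂ ,
    translates⇒shift M (ε ∷ vs)
      (⊆-trans setoid B₂⊆∪ (++⁺ˡ setoid _ B₁⊆B₁+ε) , ⊆-trans setoid (++⁺ˡ setoid _ B₁+ε⊆B₁) ∪⊆B₂)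
    where
    open Subset setoid using (_⊆_)
    B₁+ε⊆B₁ : _+ₛ_ M B₁ ε ⊆ B₁
    B₁+ε⊆B₁ = proj₁ (+ₛ-identityʳ M B₁)
    B₁⊆B₁+ε : B₁ ⊆ _+ₛ_ M B₁ ε
    B₁⊆B₁+ε = proj₂ (+ₛ-identityʳ M B₁)
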